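{- Let $G=(V,E)$ be a finite simple graph and $A_G$ its adjacency matrix. Then $G$ simultaneously satisfies (i) $G$ is chordal (no induced cycle of length at least 4), (ii) $G$ has no induced claw $K_{1,3}$, and (iii) $G$ has no asteroidal triple, if and only if $A_G$ has no weighted asteroidal triple.
   Context: $A_G$ is the $V\times V$ symmetric $0/1$ matrix with $(A_G)_{uv}=1$ iff $\{u,v\}\in E$ for $u\ne v$. For a symmetric matrix $A$ indexed by $V$ and $z\in V$, a path avoiding $z$ in $A$ is a sequence $(v_0,\dots,v_m)$ ($m\ge0$) of distinct elements of $V\setminus\{z\}$ with $A_{v_{i-1}v_i}>\min\{A_{v_{i-1}z},A_{v_iz}\}$ for $1\le i\le m$; $x\overset{z}{\sim}y$ means such a path from $x$ to $y$ exists. A weighted asteroidal triple of $A$ is a set $\{x,y,z\}$ of three distinct elements with $x\overset{z}{\sim}y$, $y\overset{x}{\sim}z$, $z\overset{y}{\sim}x$. A path in $G$ from $x$ to $y$ misses $z$ if $z$ is adjacent to no vertex of the path. An asteroidal triple of $G$ is an independent set $\{x,y,z\}$ of three vertices such that between any two of them there is a path in $G$ missing the third. -}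

module Defs where

open import Data.Nat using (ℕ; zero; suc; _<_; _≤_; _⊔_; _⊓_; _∸_)
open import Data.Fin using (Fin; toℕ)
open import Data.Bool using (Bool; true; false; if_then_else_)
open import Data.List using (List; []; _∷_)
open import Data.List.Relation.Unary.All using (All)
open import Data.List.Relation.Unary.Unique.Propositional using (Unique)
open import Data.Product using (Σ; _×_; ∃; ∃-syntax)
open import Data.Sum using (_⊎_)
open import Function.Definitions using (Injective)
open import Relation.Binary.PropositionalEquality using (_≡_; _≢_)
open import Relation.Nullary using (¬_)

record SimpleGraph (n : ℕ) : Set where
  field
    adj     : Fin n → Fin n → Bool
    symm    : ∀ u v → adj u v ≡ adj v u
    irrefl  : ∀ v → adj v v ≡ false

open SimpleGraph public

Adj : ∀ {n} → SimpleGraph n → Fin n → Fin n → Set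
Adj G u v = adj G u v ≡ true

Matrix : ℕ → Set
Matrix n = Fin n → Fin n → ℕ

adjMatrix : ∀ {n} → SimpleGraph n → Matrix n
adjMatrix G u v = if adj G u v then 1 else 0

WStep : ∀ {n} → Matrix n → Fin n → Fin n → Fin n → Set
WStep A z u v = (A u z ⊓ A v z) < A u v

data WChain {n} (A : Matrix n) (z : Fin n) : Fin n → Fin n → List (Fin n) → Set where
  wsingle : ∀ x → WChain A z x x (x ∷ [])
  wstep   : ∀ {x v y vs} → WStep A z x v → WChain A z v y vs → WChain A z x y (x ∷ vs)

PathAvoiding : ∀ {n} → Matrix n → Fin n → Fin n → Fin n → Set
PathAvoiding A z x y =
  ∃[ vs ] (WChain A z x y vs × Unique vs × All (λ v → v ≢ z) vs)

WeightedAsteroidalTriple : ∀ {n} → Matrix n → Fin n → Fin n → Fin n → Set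
WeightedAsteroidalTriple A x y z =
  x ≢ y × y ≢ z × x ≢ z ×
  PathAvoiding A z x y × PathAvoiding A x y z × PathAvoiding A y z x

HasWeightedAsteroidalTriple : ∀ {n} → Matrix n → Set
HasWeightedAsteroidalTriple {n} A =
  ∃[ x ] ∃[ y ] ∃[ z ] WeightedAsteroidalTriple A x y z

data GChain {n} (G : SimpleGraph n) : Fin n → Fin n → List (Fin n) → Set where
  gsingle : ∀ x → GChain G x x (x ∷ [])
  gstep   : ∀ {x v y vs} → Adj G x v → GChain G v y vs → GChain G x y (x ∷ vs)

PathMissing : ∀ {n} → SimpleGraph n → Fin n → Fin n → Fin n → Set
PathMissing G z x y =
  ∃[ vs ] (GChain G x y vs × Unique vs × All (λ v → ¬ Adj G z v) vs)

AsteroidalTriple : ∀ {n} → SimpleGraph n → Fin n → Fin n → Fin n → Set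
AsteroidalTriple G x y z =
  x ≢ y × y ≢ z × x ≢ z ×
  ¬ Adj G x y × ¬ Adj G y z × ¬ Adj G x z ×
  PathMissing G z x y × PathMissing G x y z × PathMissing G y z x

HasAsteroidalTriple : ∀ {n} → SimpleGraph n → Set
HasAsteroidalTriple {n} G = ∃[ x ] ∃[ y ] ∃[ z ] AsteroidalTriple G x y z

CycAdj : ∀ {k} → Fin k → Fin k → Set
CycAdj {k} i j =
  suc (toℕ i) ≡ toℕ j ⊎ suc (toℕ j) ≡ toℕ i ⊎
  (toℕ i ≡ 0 × toℕ j ≡ k ∸ 1) ⊎ (toℕ j ≡ 0 × toℕ i ≡ k ∸ 1)

InducedCycle : ∀ {n} → SimpleGraph n → (k : ℕ) → (Fin k → Fin n) → Set
InducedCycle G k c =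
  Injective _≡_ _≡_ c × (∀ i j → (Adj G (c i) (c j) → CycAdj i j) × (CycAdj i j → Adj G (c i) (c j)))

Chordal : ∀ {n} → SimpleGraph n → Set
Chordal G = ∀ (k : ℕ) → 4 ≤ k → (c : Fin _ → Fin _) → ¬ InducedCycle G k c

InducedClaw : ∀ {n} → SimpleGraph n → Fin n → Fin n → Fin n → Fin n → Set
InducedClaw G c a₁ a₂ a₃ =
  a₁ ≢ a₂ × a₂ ≢ a₃ × a₁ ≢ a₃ ×
  Adj G c a₁ × Adj G c a₂ × Adj G c a₃ ×
  ¬ Adj G a₁ a₂ × ¬ Adj G a₂ a₃ × ¬ Adj G a₁ a₃

ClawFree : ∀ {n} → SimpleGraph n → Set
ClawFree {n} G = ∀ (c a₁ a₂ a₃ : Fin n) → ¬ InducedClaw G c a₁ a₂ a₃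

-- For a 0/1 matrix, a step of a path avoiding z is exactly a z-edge: an edge
-- of G whose endpoints are not both adjacent to z.  We reason with walks along
-- z-edges (repetitions allowed) and recover paths by loop erasure.
--
-- Backward direction: the leaves of a claw, an asteroidal triple, or three
-- consecutive vertices of a long induced cycle form a weighted asteroidal triple.
-- Forward direction: infinite descent on the total length of a witness (three
-- avoiding walks).  Claw-freeness tidies the walks, so a witness on an edgeless
-- triple is an asteroidal triple.  Given an edge xy, the last hop r → x of the
-- walk from z either lets the witness shrink, or yields a common neighbour of
-- x and z missing y (a shortcut), or moves the witness to a triple with fewer
-- edges; shortcuts close induced 4- or 5-cycles or form an asteroidal triple.
module Submission where

open import Defs
open import Data.Nat using (ℕ; zero; suc; _+_; _<_; _≤_; _⊓_; _∸_; z≤n; s≤s)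
open import Data.Nat.Properties
  using (_≟_; ≤-refl; ≤-trans; <-≤-trans; n≤1+n; ≤-reflexive; +-mono-≤; +-mono-<-≤; +-mono-≤-<; +-comm; 0≢1+n; 1+n≢n)
open import Data.Nat.Tactic.RingSolver using (solve-∀)
open import Data.Fin using (Fin; zero; suc; toℕ; inject₁; fromℕ) renaming (_≟_ to _≟ᶠ_; _<_ to _<ᶠ_)
import Data.Fin.Properties as Fin
open import Data.Bool using (Bool; true; false; if_then_else_)
open import Data.Unit using (⊤)
open import Data.List using (List; []; _∷_; _∷ʳ_; length; reverse)
open import Data.List.Properties using (unfold-reverse; length-++; length-reverse)
open import Data.List.Relation.Unary.All as All using (All; []; _∷_)
open import Data.List.Relation.Unary.All.Properties using (++⁺; ++⁻ˡ; anti-mono; ¬Any⇒All¬)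
open import Data.List.Relation.Unary.Any using (here; there; any?)
open import Data.List.Relation.Unary.Any.Properties using (reverse⁻)
open import Data.List.Relation.Unary.AllPairs using ([]; _∷_)
open import Data.List.Relation.Unary.Unique.Propositional using (Unique)
open import Data.List.Membership.Propositional using (_∈_; find)
import Data.List.Membership.DecPropositional as DecMembership
open import Data.List.Relation.Binary.Subset.Propositional using (_⊆_)
open import Data.Vec using (_∷_; []; lookup)
open import Data.Product using (Σ; ∃; ∃₂; _×_; _,_; proj₁; proj₂)
open import Data.Sum using (_⊎_; inj₁; inj₂; [_,_])
open import Data.Empty using (⊥; ⊥-elim)
open import Function using (_∘_)
open import Function.Bundles using (_⇔_; mk⇔; Equivalence)
open import Relation.Binary using (tri<; tri≈; tri>)
open import Relation.Binary.PropositionalEquality using (_≡_; _≢_; refl; sym; trans; cong; subst; ≢-sym)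
open import Relation.Nullary using (¬_; Dec; yes; no)
open import Relation.Nullary.Decidable using (True; False; toWitness; toWitnessFalse; _⊎-dec_; _×-dec_)

data Walk {n : ℕ} (R : Fin n → Fin n → Set) : Fin n → Fin n → List (Fin n) → Set where
  stop : ∀ x → Walk R x x (x ∷ [])
  hop  : ∀ {x v y vs} → R x v → Walk R v y vs → Walk R x y (x ∷ vs)

module _ {n : ℕ} {R : Fin n → Fin n → Set} where

  private variable
    x y q w : Fin n
    vs : List (Fin n)

  walk-head : Walk R x y vs → ∃ λ t → vs ≡ x ∷ t
  walk-head (stop x)            = [] , refl
  walk-head (hop {vs = vs} _ _) = vs , refl

  walk-end : Walk R x y vs → y ∈ vs
  walk-end (stop x)  = here refl
  walk-end (hop _ p) = there (walk-end p)

  walk-length≥2 : Walk R x y vs → x ≢ y → 2 ≤ length vs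
  walk-length≥2 (stop x)           x≢y = ⊥-elim (x≢y refl)
  walk-length≥2 (hop _ (stop _))   _   = s≤s (s≤s z≤n)
  walk-length≥2 (hop _ (hop _ _))  _   = s≤s (s≤s z≤n)

  walk-snoc : Walk R x y vs → R y w → Walk R x w (vs ∷ʳ w)
  walk-snoc (stop x)  r′ = hop r′ (stop _)
  walk-snoc (hop r p) r′ = hop r (walk-snoc p r′)

  walk-last : Walk R x y vs → x ≢ y →
              ∃₂ λ r vs₀ → Walk R x r vs₀ × R r y × vs ≡ vs₀ ∷ʳ y
  walk-last (stop x)  x≢y = ⊥-elim (x≢y refl)
  walk-last (hop r p) _   = last r p
    where
      last : ∀ {x v y vs} → R x v → Walk R v y vs →
             ∃₂ λ r vs₀ → Walk R x r vs₀ × R r y × x ∷ vs ≡ vs₀ ∷ʳ y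
      last r (stop _)                = _ , _ , stop _ , r , refl
      last {x = x} r (hop r′ p) with last r′ p
      ... | r₀ , vs₀ , p₀ , r₀y , eq = r₀ , x ∷ vs₀ , hop r p₀ , r₀y , cong (x ∷_) eq

  walk-prefix : Walk R x y vs → q ∈ vs → q ≢ y →
                ∃ λ vs₁ → Walk R x q vs₁ × vs₁ ⊆ vs × length vs₁ < length vs
  walk-prefix (stop x)           (here refl) q≢y = ⊥-elim (q≢y refl)
  walk-prefix (hop r p)          (here refl) _   with walk-head p
  ... | _ , refl = _ , stop _ , (λ { (here refl) → here refl }) , s≤s (s≤s z≤n)
  walk-prefix {x = x} (hop r p)  (there q∈) q≢y with walk-prefix p q∈ q≢y
  ... | vs₁ , p₁ , ⊆vs , shorter =
    x ∷ vs₁ , hop r p₁ , (λ { (here e) → here e ; (there m) → there (⊆vs m) }) , s≤s shorter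

  walk-suffix : Walk R w y vs → x ∈ vs → Unique vs →
                ∃ λ vs₂ → Walk R x y vs₂ × Unique vs₂ × vs₂ ⊆ vs
  walk-suffix (stop _)    (here refl) u       = _ , stop _ , u , λ m → m
  walk-suffix (hop r p)   (here refl) u       = _ , hop r p , u , λ m → m
  walk-suffix (hop _ p)   (there x∈)  (_ ∷ u) with walk-suffix p x∈ u
  ... | vs₂ , p₂ , u₂ , ⊆vs = vs₂ , p₂ , u₂ , λ m → there (⊆vs m)

  walk-erase : Walk R x y vs → ∃ λ vs′ → Walk R x y vs′ × Unique vs′ × vs′ ⊆ vs
  walk-erase (stop x) = _ , stop x , [] ∷ [] , λ m → m
  walk-erase {x = x} (hop r p) with walk-erase p
  ... | vs′ , p′ , u′ , ⊆vs with DecMembership._∈?_ _≟ᶠ_ x vs′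
  ...   | yes x∈ with walk-suffix p′ x∈ u′
  ...     | vs₂ , p₂ , u₂ , ⊆vs′ = vs₂ , p₂ , u₂ , λ m → there (⊆vs (⊆vs′ m))
  walk-erase {x = x} (hop r p) | vs′ , p′ , u′ , ⊆vs | no x∉ =
    x ∷ vs′ , hop r p′ , ¬Any⇒All¬ vs′ x∉ ∷ u′ ,
    λ { (here e) → here e ; (there m) → there (⊆vs m) }

  ladder : ∀ {m} {P : Fin n → Set} (f : Fin (suc m) → Fin n) →
           (∀ i → R (f (inject₁ i)) (f (suc i))) → (∀ i → P (f i)) →
           ∃ λ vs → Walk R (f zero) (f (fromℕ m)) vs × All P vs
  ladder {zero}  f steps ok = _ , stop (f zero) , ok zero ∷ []
  ladder {suc m} f steps ok with ladder (f ∘ suc) (steps ∘ suc) (ok ∘ suc)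
  ... | vs , p , all = f zero ∷ vs , hop (steps zero) p , ok zero ∷ all

module _ {n : ℕ} {R R′ : Fin n → Fin n → Set} where

  private variable
    x y : Fin n
    vs : List (Fin n)

  walk-map : (∀ {u v} → R u v → R′ u v) → Walk R x y vs → Walk R′ x y vs
  walk-map f (stop x)  = stop x
  walk-map f (hop r p) = hop (f r) (walk-map f p)

  walk-restrict : ∀ {P : Fin n → Set} → (∀ {u v} → P u → P v → R u v → R′ u v) →
                  Walk R x y vs → All P vs → Walk R′ x y vs
  walk-restrict f (stop x)  _         = stop x
  walk-restrict f (hop r p) (pu ∷ ps) = hop (f pu (source p ps) r) (walk-restrict f p ps)
    where
      source : ∀ {P : Fin n → Set} {v y vs} → Walk R v y vs → All P vs → P v
      source (stop _)  (pv ∷ _) = pv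
      source (hop _ _) (pv ∷ _) = pv

walk-reverse : ∀ {n} {R : Fin n → Fin n → Set} {x y vs} →
               (∀ {u v} → R u v → R v u) → Walk R x y vs → Walk R y x (reverse vs)
walk-reverse R-sym (stop x) = stop x
walk-reverse {x = x} R-sym (hop {vs = vs} r p) =
  subst (Walk _ _ x) (sym (unfold-reverse x vs)) (walk-snoc (walk-reverse R-sym p) (R-sym r))

module _ {n : ℕ} where

  private variable
    x y z : Fin n
    vs : List (Fin n)

  walk⇒gchain : ∀ {G : SimpleGraph n} → Walk (Adj G) x y vs → GChain G x y vs
  walk⇒gchain (stop x)  = gsingle x
  walk⇒gchain (hop e p) = gstep e (walk⇒gchain p)

  gchain⇒walk : ∀ {G : SimpleGraph n} → GChain G x y vs → Walk (Adj G) x y vs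
  gchain⇒walk (gsingle x) = stop x
  gchain⇒walk (gstep e p) = hop e (gchain⇒walk p)

  walk⇒wchain : ∀ {A : Matrix n} → Walk (WStep A z) x y vs → WChain A z x y vs
  walk⇒wchain (stop x)  = wsingle x
  walk⇒wchain (hop s p) = wstep s (walk⇒wchain p)

  wchain⇒walk : ∀ {A : Matrix n} → WChain A z x y vs → Walk (WStep A z) x y vs
  wchain⇒walk (wsingle x) = stop x
  wchain⇒walk (wstep s p) = hop s (wchain⇒walk p)

bit : Bool → ℕ
bit b = if b then 1 else 0

bit-min< : ∀ a b c → (bit b ⊓ bit c < bit a) ⇔ (a ≡ true × ¬ (b ≡ true × c ≡ true))
bit-min< a b c = mk⇔ (to a b c) (from a b c)
  where
    to : ∀ a b c → bit b ⊓ bit c < bit a → a ≡ true × ¬ (b ≡ true × c ≡ true)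
    to false _     _     ()
    to true  true  true  (s≤s ())
    to true  true  false _ = refl , λ ()
    to true  false _     _ = refl , λ ()
    from : ∀ a b c → a ≡ true × ¬ (b ≡ true × c ≡ true) → bit b ⊓ bit c < bit a
    from true true  true  (_ , not-both) = ⊥-elim (not-both (refl , refl))
    from true true  false _              = s≤s z≤n
    from true false _     _              = s≤s z≤n

cycAdj-sym : ∀ {k} {i j : Fin k} → CycAdj i j → CycAdj j i
cycAdj-sym (inj₁ p)               = inj₂ (inj₁ p)
cycAdj-sym (inj₂ (inj₁ p))        = inj₁ p
cycAdj-sym (inj₂ (inj₂ (inj₁ p))) = inj₂ (inj₂ (inj₂ p))
cycAdj-sym (inj₂ (inj₂ (inj₂ p))) = inj₂ (inj₂ (inj₁ p))

cycAdj? : ∀ {k} (i j : Fin k) → Dec (CycAdj i j)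
cycAdj? {k} i j =
  suc (toℕ i) ≟ toℕ j ⊎-dec suc (toℕ j) ≟ toℕ i ⊎-dec
  (toℕ i ≟ 0 ×-dec toℕ j ≟ k ∸ 1) ⊎-dec (toℕ j ≟ 0 ×-dec toℕ i ≟ k ∸ 1)

cycAdj-irrefl : ∀ {k} {i : Fin (2 + k)} → ¬ CycAdj i i
cycAdj-irrefl (inj₁ p)                     = 1+n≢n p
cycAdj-irrefl (inj₂ (inj₁ p))              = 1+n≢n p
cycAdj-irrefl (inj₂ (inj₂ (inj₁ (p , q)))) = 0≢1+n (trans (sym p) q)
cycAdj-irrefl (inj₂ (inj₂ (inj₂ (p , q)))) = 0≢1+n (trans (sym p) q)

module GraphFacts {n : ℕ} (G : SimpleGraph n) where

  private variable
    x y z : Fin n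

  infix 4 _~_ _≁_
  _~_ _≁_ : Fin n → Fin n → Set
  u ~ v = Adj G u v
  u ≁ v = ¬ u ~ v

  ~-sym : ∀ {u v} → u ~ v → v ~ u
  ~-sym {u} {v} e = trans (symm G v u) e

  ≁-sym : ∀ {u v} → u ≁ v → v ≁ u
  ≁-sym ne e = ne (~-sym e)

  ~-irrefl : ∀ {u} → u ≁ u
  ~-irrefl {u} e with trans (sym e) (irrefl G u)
  ... | ()

  ~⇒≢ : ∀ {u v} → u ~ v → u ≢ v
  ~⇒≢ e refl = ~-irrefl e

  _~?_ : ∀ u v → Dec (u ~ v)
  u ~? v = Data.Bool._≟_ (adj G u v) true

  ZEdge : Fin n → Fin n → Fin n → Set
  ZEdge z u v = u ~ v × ¬ (u ~ z × v ~ z)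

  wstep⇔zedge : ∀ {z u v} → WStep (adjMatrix G) z u v ⇔ ZEdge z u v
  wstep⇔zedge {z} {u} {v} = bit-min< (adj G u v) (adj G u z) (adj G v z)

  zedge-sym : ∀ {z u v} → ZEdge z u v → ZEdge z v u
  zedge-sym (e , not-both) = ~-sym e , λ (vz , uz) → not-both (uz , vz)

  zedgeˡ : ∀ {z u v} → u ~ v → u ≁ z → ZEdge z u v
  zedgeˡ e uz = e , λ (u~z , _) → uz u~z

  zedgeʳ : ∀ {z u v} → u ~ v → v ≁ z → ZEdge z u v
  zedgeʳ e vz = e , λ (_ , v~z) → vz v~z

  zedge-other : ∀ {z u v} → ZEdge z u v → u ~ z → v ≁ z
  zedge-other (_ , not-both) uz vz = not-both (uz , vz)

  inducedCycle-byPairs : ∀ {k} (c : Fin (2 + k) → Fin n) →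
    (∀ i j → i <ᶠ j → c i ≢ c j × (c i ~ c j ⇔ CycAdj i j)) → InducedCycle G (2 + k) c
  inducedCycle-byPairs c pair = injective , adjacency
    where
      injective : ∀ {i j} → c i ≡ c j → i ≡ j
      injective {i} {j} eq with Fin.<-cmp i j
      ... | tri< i<j _ _ = ⊥-elim (proj₁ (pair i j i<j) eq)
      ... | tri≈ _ i≡j _ = i≡j
      ... | tri> _ _ j<i = ⊥-elim (proj₁ (pair j i j<i) (sym eq))
      adjacency : ∀ i j → (c i ~ c j → CycAdj i j) × (CycAdj i j → c i ~ c j)
      adjacency i j with Fin.<-cmp i j
      ... | tri< i<j _ _  = Equivalence.to (proj₂ (pair i j i<j)) , Equivalence.from (proj₂ (pair i j i<j))
      ... | tri≈ _ refl _ = (λ e → ⊥-elim (~-irrefl e)) , (λ a → ⊥-elim (cycAdj-irrefl a))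
      ... | tri> _ _ j<i  = (λ e → cycAdj-sym (Equivalence.to (proj₂ (pair j i j<i)) (~-sym e))) ,
                            (λ a → ~-sym (Equivalence.from (proj₂ (pair j i j<i)) (cycAdj-sym a)))

  cycle-edge : ∀ {k} {i j : Fin k} {u v} {consecutive : True (cycAdj? i j)} →
               u ~ v → u ≢ v × (u ~ v ⇔ CycAdj i j)
  cycle-edge {consecutive = consecutive} e =
    ~⇒≢ e , mk⇔ (λ _ → toWitness consecutive) (λ _ → e)

  cycle-chord : ∀ {k} {i j : Fin k} {u v} {apart : False (cycAdj? i j)} →
                u ≁ v → u ≢ v → u ≢ v × (u ~ v ⇔ CycAdj i j)
  cycle-chord {apart = apart} ne d =
    d , mk⇔ (λ e → ⊥-elim (ne e)) (λ a → ⊥-elim (toWitnessFalse apart a))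

  module _ (chordal : Chordal G) where

    no-C4 : ∀ {v₀ v₁ v₂ v₃} → v₀ ~ v₁ → v₁ ~ v₂ → v₂ ~ v₃ → v₃ ~ v₀ →
            v₀ ≁ v₂ → v₁ ≁ v₃ → v₀ ≢ v₂ → v₁ ≢ v₃ → ⊥
    no-C4 {v₀} {v₁} {v₂} {v₃} e01 e12 e23 e30 n02 n13 d02 d13 =
      chordal 4 (s≤s (s≤s (s≤s (s≤s z≤n)))) c (inducedCycle-byPairs c pair)
      where
        c : Fin 4 → Fin n
        c = lookup (v₀ ∷ v₁ ∷ v₂ ∷ v₃ ∷ [])
        pair : ∀ i j → i <ᶠ j → c i ≢ c j × (c i ~ c j ⇔ CycAdj i j)
        pair zero             (suc zero)                _ = cycle-edge e01
        pair zero             (suc (suc zero))          _ = cycle-chord n02 d02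
        pair zero             (suc (suc (suc zero)))    _ = cycle-edge (~-sym e30)
        pair (suc zero)       (suc (suc zero))          _ = cycle-edge e12
        pair (suc zero)       (suc (suc (suc zero)))    _ = cycle-chord n13 d13
        pair (suc (suc zero)) (suc (suc (suc zero)))    _ = cycle-edge e23
        pair _                zero                      ()
        pair (suc _)          (suc zero)                (s≤s ())
        pair (suc (suc _))    (suc (suc zero))          (s≤s (s≤s ()))
        pair (suc (suc (suc _))) (suc (suc (suc zero))) (s≤s (s≤s (s≤s ())))

    no-C5 : ∀ {v₀ v₁ v₂ v₃ v₄} → v₀ ~ v₁ → v₁ ~ v₂ → v₂ ~ v₃ → v₃ ~ v₄ → v₄ ~ v₀ →
            v₀ ≁ v₂ → v₀ ≁ v₃ → v₁ ≁ v₃ → v₁ ≁ v₄ → v₂ ≁ v₄ →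
            v₀ ≢ v₂ → v₀ ≢ v₃ → v₁ ≢ v₃ → v₁ ≢ v₄ → v₂ ≢ v₄ → ⊥
    no-C5 {v₀} {v₁} {v₂} {v₃} {v₄} e01 e12 e23 e34 e40 n02 n03 n13 n14 n24 d02 d03 d13 d14 d24 =
      chordal 5 (s≤s (s≤s (s≤s (s≤s z≤n)))) c (inducedCycle-byPairs c pair)
      where
        c : Fin 5 → Fin n
        c = lookup (v₀ ∷ v₁ ∷ v₂ ∷ v₃ ∷ v₄ ∷ [])
        pair : ∀ i j → i <ᶠ j → c i ≢ c j × (c i ~ c j ⇔ CycAdj i j)
        pair zero                   (suc zero)                   _ = cycle-edge e01
        pair zero                   (suc (suc zero))             _ = cycle-chord n02 d02
        pair zero                   (suc (suc (suc zero)))       _ = cycle-chord n03 d03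
        pair zero                   (suc (suc (suc (suc zero)))) _ = cycle-edge (~-sym e40)
        pair (suc zero)             (suc (suc zero))             _ = cycle-edge e12
        pair (suc zero)             (suc (suc (suc zero)))       _ = cycle-chord n13 d13
        pair (suc zero)             (suc (suc (suc (suc zero)))) _ = cycle-chord n14 d14
        pair (suc (suc zero))       (suc (suc (suc zero)))       _ = cycle-edge e23
        pair (suc (suc zero))       (suc (suc (suc (suc zero)))) _ = cycle-chord n24 d24
        pair (suc (suc (suc zero))) (suc (suc (suc (suc zero)))) _ = cycle-edge e34
        pair _                      zero                         ()
        pair (suc _)                (suc zero)                   (s≤s ())
        pair (suc (suc _))          (suc (suc zero))             (s≤s (s≤s ()))
        pair (suc (suc (suc _)))    (suc (suc (suc zero)))       (s≤s (s≤s (s≤s ())))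
        pair (suc (suc (suc (suc _)))) (suc (suc (suc (suc zero)))) (s≤s (s≤s (s≤s (s≤s ()))))

  path-missing : ∀ {m a b c} → a ~ b → b ~ c → a ≢ c → m ≁ a → m ≁ b → m ≁ c → PathMissing G m a c
  path-missing a~b b~c a≢c m≁a m≁b m≁c =
    _ ∷ _ ∷ _ ∷ [] , gstep a~b (gstep b~c (gsingle _)) ,
    (~⇒≢ a~b ∷ a≢c ∷ []) ∷ (~⇒≢ b~c ∷ []) ∷ [] ∷ [] , m≁a ∷ m≁b ∷ m≁c ∷ []

  -- Unlike a path avoiding z, vertices may repeat, so such
  -- walks can be shortened and rerouted freely.
  record AvoidingWalk (z x y : Fin n) : Set where
    constructor avoiding
    field
      verts  : List (Fin n)
      walk   : Walk (ZEdge z) x y verts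
      avoids : All (_≢ z) verts
  open AvoidingWalk public

  len : AvoidingWalk z x y → ℕ
  len w = length (verts w)

  reverseWalk : AvoidingWalk z x y → AvoidingWalk z y x
  reverseWalk (avoiding vs p av) = avoiding (reverse vs) (walk-reverse zedge-sym p) (anti-mono reverse⁻ av)

  len-reverse : (w : AvoidingWalk z x y) → len (reverseWalk w) ≡ len w
  len-reverse w = length-reverse (verts w)

  fromPathAvoiding : PathAvoiding (adjMatrix G) z x y → AvoidingWalk z x y
  fromPathAvoiding (vs , p , _ , av) = avoiding vs (walk-map (Equivalence.to wstep⇔zedge) (wchain⇒walk p)) av

  toPathAvoiding : AvoidingWalk z x y → PathAvoiding (adjMatrix G) z x y
  toPathAvoiding (avoiding _ p av) with walk-erase p
  ... | vs′ , p′ , unique , ⊆vs =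
    vs′ , walk⇒wchain (walk-map (Equivalence.from wstep⇔zedge) p′) , unique , anti-mono ⊆vs av

module Forward {n : ℕ} (G : SimpleGraph n) where
  open GraphFacts G

  private variable
    x y z : Fin n

  -- A weighted asteroidal triple in walk form; its size is the total length
  -- of the three walks, on which the proof of the forward direction descends.
  record Witness (x y z : Fin n) : Set where
    constructor witness
    field
      x≢y : x ≢ y
      y≢z : y ≢ z
      x≢z : x ≢ z
      P   : AvoidingWalk z x y
      Q   : AvoidingWalk x y z
      R   : AvoidingWalk y z x
  open Witness

  size : Witness x y z → ℕ
  size w = len (P w) + len (Q w) + len (R w)

  rotate : Witness x y z → Witness y z x
  rotate (witness x≢y y≢z x≢z P Q R) = witness y≢z (≢-sym x≢z) (≢-sym x≢y) Q R P

  mirror : Witness x y z → Witness y x z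
  mirror (witness x≢y y≢z x≢z P Q R) = witness (≢-sym x≢y) x≢z y≢z (reverseWalk P) (reverseWalk R) (reverseWalk Q)

  size-rotate : (w : Witness x y z) → size (rotate w) ≡ size w
  size-rotate w = rotate-sum (len (P w)) (len (Q w)) (len (R w))
    where
      rotate-sum : ∀ a b c → b + c + a ≡ a + b + c
      rotate-sum = solve-∀

  size-mirror : (w : Witness x y z) → size (mirror w) ≡ size w
  size-mirror (witness _ _ _ P Q R)
    rewrite len-reverse P | len-reverse Q | len-reverse R = swap-sum (len P) (len Q) (len R)
    where
      swap-sum : ∀ a b c → a + c + b ≡ a + b + c
      swap-sum = solve-∀

  SmallerThan : ℕ → Set
  SmallerThan m = ∃ λ x → ∃ λ y → ∃ λ z → Σ (Witness x y z) λ w → size w < m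

  smaller-mono : ∀ {m m′} → m ≤ m′ → SmallerThan m → SmallerThan m′
  smaller-mono m≤m′ (x , y , z , w , small) = x , y , z , w , <-≤-trans small m≤m′

  Reducible : Fin n → Fin n → Fin n → Set
  Reducible x y z = (w : Witness x y z) → SmallerThan (size w)

  reducible-rotate : Reducible y z x → Reducible x y z
  reducible-rotate red w = smaller-mono (≤-reflexive (size-rotate w)) (red (rotate w))

  no-witness : (∀ {x y z} → Reducible x y z) → Witness x y z → ⊥
  no-witness red w = below (suc (size w)) w ≤-refl
    where
      below : ∀ b {x y z} (w : Witness x y z) → size w < b → ⊥
      below (suc b) w (s≤s size≤b) with red w
      ... | _ , _ , _ , w′ , smaller = below b w′ (<-≤-trans smaller size≤b)

  Tidy : Fin n → Fin n → List (Fin n) → Set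
  Tidy y z []       = ⊤
  Tidy y z (_ ∷ vs) = All (λ v → v ≡ y ⊎ v ≁ z) vs

  TidyWitness : Witness x y z → Set
  TidyWitness {x} {y} {z} w = Tidy y z (verts (P w)) × Tidy z x (verts (Q w)) × Tidy x y (verts (R w))

  module Tidying (claw-free : ClawFree G) where

    -- Claw-freeness at v: two z-edges s–v–u through a neighbour v of z
    -- (hence s, u ≁ z) can be short-cut by an edge s–u.
    shortcut : ∀ {z s v u} → ZEdge z s v → ZEdge z v u → v ~ z → s ≢ z → u ≢ z → s ≢ u → s ~ u
    shortcut {z} {s} {v} {u} sv vu v~z s≢z u≢z s≢u with s ~? u
    ... | yes s~u = s~u
    ... | no  s≁u = ⊥-elim (claw-free v s z u
          (s≢z , ≢-sym u≢z , s≢u , ~-sym (proj₁ sv) , v~z , proj₁ vu ,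
           s≁z , ≁-sym u≁z , s≁u))
      where
        s≁z : s ≁ z
        s≁z = zedge-other (zedge-sym sv) v~z
        u≁z : u ≁ z
        u≁z = zedge-other vu v~z

    TidyWalk : Fin n → Fin n → Fin n → ℕ → Set
    TidyWalk z s y m = Σ (AvoidingWalk z s y) λ w → len w ≤ m × Tidy y z (verts w)

    bypass : ∀ {z s v y m} → ZEdge z s v → s ≢ z → v ~ z → v ≢ y →
             TidyWalk z v y m → TidyWalk z s y m
    bypass _ _ _ v≢y (avoiding _ (stop _) _ , _) = ⊥-elim (v≢y refl)
    bypass {s = s} sv s≢z v~z v≢y
           (avoiding (_ ∷ vs) (hop {v = u} vu p) (_ ∷ av) , s≤s len≤m , _ ∷ tidy)
      with walk-head p | av
    ... | _ , refl | u≢z ∷ _ with s ≟ᶠ u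
    ...   | yes refl = avoiding vs p av , ≤-trans len≤m (n≤1+n _) , tidy
    ...   | no  s≢u  = avoiding (s ∷ vs) (hop su p) (s≢z ∷ av) , s≤s len≤m , inj₂ u≁z ∷ tidy
      where
        u≁z : u ≁ _
        u≁z = zedge-other vu v~z
        su : ZEdge _ s u
        su = zedgeˡ (shortcut sv vu v~z s≢z u≢z s≢u) (zedge-other (zedge-sym sv) v~z)

    tidy-walk : ∀ {z s y vs} → Walk (ZEdge z) s y vs → All (_≢ z) vs → TidyWalk z s y (length vs)
    tidy-walk (stop s) av = avoiding _ (stop s) av , ≤-refl , []
    tidy-walk {z} {s} {y} (hop {v = v} sv p) (s≢z ∷ av) with tidy-walk p av
    ... | tail@(avoiding _ p′ av′ , len≤ , tidy) with walk-head p′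
    ...   | _ , refl with v ~? z | v ≟ᶠ y
    ...     | no v≁z | _       = avoiding _ (hop sv p′) (s≢z ∷ av′) , s≤s len≤ , inj₂ v≁z ∷ tidy
    ...     | yes _  | yes v≡y = avoiding _ (hop sv p′) (s≢z ∷ av′) , s≤s len≤ , inj₁ v≡y ∷ tidy
    ...     | yes v~z | no v≢y
      with bypass sv s≢z v~z v≢y tail
    ...       | w , len≤′ , tidy′ = w , ≤-trans len≤′ (n≤1+n _) , tidy′

    tidy-avoiding : (w : AvoidingWalk z x y) → TidyWalk z x y (len w)
    tidy-avoiding (avoiding _ p av) = tidy-walk p av

    tidy-witness : (w : Witness x y z) → Σ (Witness x y z) λ w′ → size w′ ≤ size w × TidyWitness w′
    tidy-witness (witness x≢y y≢z x≢z P Q R)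
      with tidy-avoiding P | tidy-avoiding Q | tidy-avoiding R
    ... | P′ , P≤ , tP | Q′ , Q≤ , tQ | R′ , R≤ , tR =
      witness x≢y y≢z x≢z P′ Q′ R′ , +-mono-≤ (+-mono-≤ P≤ Q≤) R≤ , tP , tQ , tR

  tidy-member : ∀ {q} (w : AvoidingWalk z x y) → Tidy y z (verts w) → q ∈ verts w → q ≢ x → q ≡ y ⊎ q ≁ z
  tidy-member (avoiding _ p _) tidy q∈ q≢x with walk-head p
  tidy-member (avoiding _ p _) tidy (here q≡x) q≢x | _ , refl = ⊥-elim (q≢x q≡x)
  tidy-member (avoiding _ p _) tidy (there q∈) _   | _ , refl = All.lookup tidy q∈

  split-last : (R : AvoidingWalk y z x) → z ≢ x →
               ∃ λ r → Σ (AvoidingWalk y z r) λ R₀ → ZEdge y r x × len R ≡ suc (len R₀)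
  split-last {x = x} (avoiding _ p av) z≢x with walk-last p z≢x
  ... | r , vs₀ , p₀ , rx , refl =
    r , avoiding vs₀ p₀ (++⁻ˡ vs₀ av) , rx , trans (length-++ vs₀) (+-comm (length vs₀) 1)

  Shortcut : Fin n → Fin n → Fin n → Set
  Shortcut x y z = ∃ λ r → r ~ z × r ~ x × r ≁ y × r ≢ y

  Detached : Fin n → Fin n → Fin n → ℕ → Set
  Detached x y z m = ∃ λ r → Σ (Witness r y z) (λ w → size w ≤ m) × r ≁ y × r ≁ z

  Outcome : Fin n → Fin n → Fin n → ℕ → Set
  Outcome x y z m = SmallerThan m ⊎ Shortcut x y z ⊎ Detached x y z m

  module LastHop {x y z r : Fin n} (x≢y : x ≢ y) (y≢z : y ≢ z) (x~y : x ~ y) (x~z⇒y~z : x ~ z → y ~ z)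
                 (P : AvoidingWalk z x y) (Q : AvoidingWalk x y z) (tidyQ : Tidy z x (verts Q))
                 (R₀ : AvoidingWalk y z r) (rx : ZEdge y r x) where

    r≁y : r ≁ y
    r≁y = zedge-other (zedge-sym rx) x~y

    r≢y : r ≢ y
    r≢y = All.lookup (avoids R₀) (walk-end (walk R₀))

    r≢z : r ≢ z
    r≢z refl = r≁y (~-sym (x~z⇒y~z (~-sym (proj₁ rx))))

    -- If no vertex of Q is r or a neighbour of r, then Q avoids r as well,
    -- and (r·P, Q, R₀) is a witness on (r, y, z) of the same size.
    detach : All (λ q → ¬ (q ≡ r ⊎ q ~ r)) (verts Q) → r ≁ z → Witness r y z
    detach far r≁z = witness r≢y y≢z r≢z
      (avoiding (r ∷ verts P) (hop (zedgeˡ (proj₁ rx) r≁z) (walk P)) (r≢z ∷ avoids P))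
      (avoiding (verts Q) (walk-restrict (λ u-far _ e → zedgeˡ (proj₁ e) (u-far ∘ inj₂)) (walk Q) far)
                          (All.map (_∘ inj₁) far))
      R₀

    size-detach : ∀ far r≁z → size (detach far r≁z) ≡ len P + len Q + suc (len R₀)
    size-detach _ _ = shift (len P) (len Q) (len R₀)
      where
        shift : ∀ a b c → suc a + b + c ≡ a + b + suc c
        shift = solve-∀

    detour : ∀ {q} → q ≡ r ⊎ q ~ r → q ≢ y → Σ (AvoidingWalk y q x) λ w → len w ≤ 3
    detour (inj₁ refl) _   = avoiding (r ∷ x ∷ []) (hop rx (stop x)) (r≢y ∷ x≢y ∷ []) , s≤s (s≤s z≤n)
    detour (inj₂ q~r)  q≢y = avoiding (_ ∷ r ∷ x ∷ []) (hop (zedgeʳ q~r r≁y) (hop rx (stop x)))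
                                      (q≢y ∷ r≢y ∷ x≢y ∷ []) , ≤-refl

    -- Otherwise some q on Q is r or a neighbour of r; then (x, y, q) carries
    -- the strictly smaller witness (x y, Q up to q, q (r) x).
    module _ {q} (q∈Q : q ∈ verts Q) (near : q ≡ r ⊎ q ~ r) (r≁z : r ≁ z) where

      q≢y : q ≢ y
      q≢y refl = [ (λ q≡r → r≢y (sym q≡r)) , (λ q~r → r≁y (~-sym q~r)) ] near

      q≢z : q ≢ z
      q≢z refl = [ (λ q≡r → r≢z (sym q≡r)) , (λ q~r → r≁z (~-sym q~r)) ] near

      q≢x : q ≢ x
      q≢x = All.lookup (avoids Q) q∈Q

      q≁x : q ≁ x
      q≁x = [ (λ q≡z → ⊥-elim (q≢z q≡z)) , (λ q≁x → q≁x) ] (tidy-member Q tidyQ q∈Q q≢y)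

      P′ : AvoidingWalk q x y
      P′ = avoiding (x ∷ y ∷ []) (hop (zedgeˡ x~y (≁-sym q≁x)) (stop y)) (≢-sym q≢x ∷ ≢-sym q≢y ∷ [])

      Q′ : Σ (AvoidingWalk x y q) λ w → len w < len Q
      Q′ with walk-prefix (walk Q) q∈Q q≢z
      ... | vs₁ , p₁ , ⊆Q , shorter = avoiding vs₁ p₁ (anti-mono ⊆Q (avoids Q)) , shorter

      shorten : Witness x y q
      shorten = witness x≢y (≢-sym q≢y) (≢-sym q≢x) P′ (proj₁ Q′) (proj₁ (detour near q≢y))

      size-shorten : size shorten < len P + len Q + suc (len R₀)
      size-shorten = +-mono-<-≤ (+-mono-≤-< (walk-length≥2 (walk P) x≢y) (proj₂ Q′))
                                (≤-trans (proj₂ (detour near q≢y)) (s≤s (walk-length≥2 (walk R₀) (≢-sym r≢z))))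

    analyse : Outcome x y z (len P + len Q + suc (len R₀))
    analyse with r ~? z
    ... | yes r~z = inj₂ (inj₁ (r , r~z , proj₁ rx , r≁y , r≢y))
    ... | no  r≁z with any? (λ q → q ≟ᶠ r ⊎-dec q ~? r) (verts Q)
    ...   | yes some-near with find some-near
    ...     | q , q∈Q , near = inj₁ (x , y , q , shorten q∈Q near r≁z , size-shorten q∈Q near r≁z)
    analyse | no r≁z | no none =
      inj₂ (inj₂ (r , (detach far r≁z , ≤-reflexive (size-detach far r≁z)) , r≁y , r≁z))
      where
        far : All (λ q → ¬ (q ≡ r ⊎ q ~ r)) (verts Q)
        far = ¬Any⇒All¬ (verts Q) none

  last-hop : (w : Witness x y z) → TidyWitness w → x ~ y → (x ~ z → y ~ z) → Outcome x y z (size w)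
  last-hop {x} {y} {z} (witness x≢y y≢z x≢z P Q R) (_ , tidyQ , _) x~y x~z⇒y~z
    with split-last R (≢-sym x≢z)
  ... | r , R₀ , rx , lenR =
    subst (Outcome x y z) (cong (len P + len Q +_) (sym lenR))
          (LastHop.analyse x≢y y≢z x~y x~z⇒y~z P Q tidyQ R₀ rx)

  module Descent (chordal : Chordal G) (claw-free : ClawFree G)
                 (at-free : ¬ HasAsteroidalTriple G) where
    open Tidying claw-free

    missing : (w : AvoidingWalk z x y) → Tidy y z (verts w) → x ≁ z → y ≁ z → PathMissing G z x y
    missing {z} {x} {y} (avoiding _ p _) tidy x≁z y≁z with walk-head p
    ... | _ , refl with walk-erase (walk-map proj₁ p)
    ... | vs′ , p′ , unique , ⊆vs =
      vs′ , walk⇒gchain p′ , unique , anti-mono ⊆vs (≁-sym x≁z ∷ All.map misses tidy)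
      where
        misses : ∀ {v} → v ≡ y ⊎ v ≁ z → z ≁ v
        misses (inj₁ refl) = ≁-sym y≁z
        misses (inj₂ v≁z)  = ≁-sym v≁z

    independent : Witness x y z → x ≁ y → y ≁ z → x ≁ z → ⊥
    independent {x} {y} {z} w x≁y y≁z x≁z with tidy-witness w
    ... | witness x≢y y≢z x≢z P Q R , _ , tP , tQ , tR =
      at-free (x , y , z , x≢y , y≢z , x≢z , x≁y , y≁z , x≁z ,
               missing P tP x≁z y≁z , missing Q tQ (≁-sym x≁y) (≁-sym x≁z) , missing R tR (≁-sym y≁z) x≁y)

    -- Two shortcuts across an edge xy whose ends miss z close an induced
    -- 4-cycle x r q y (if q ~ r) or an induced 5-cycle x y q z r.
    no-double-shortcut : x ≢ z → y ≢ z → x ~ y → x ≁ z → y ≁ z → Shortcut x y z → Shortcut y x z → ⊥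
    no-double-shortcut x≢z y≢z x~y x≁z y≁z (r , r~z , r~x , r≁y , r≢y) (q , q~z , q~y , q≁x , q≢x)
      with q ~? r
    ... | yes q~r = no-C4 chordal x~y (~-sym q~y) q~r r~x (≁-sym q≁x) (≁-sym r≁y) (≢-sym q≢x) (≢-sym r≢y)
    ... | no  q≁r = no-C5 chordal x~y (~-sym q~y) q~z (~-sym r~z) r~x
                      (≁-sym q≁x) x≁z y≁z (≁-sym r≁y) q≁r
                      (≢-sym q≢x) x≢z y≢z (≢-sym r≢y) (λ q≡r → r≁y (subst (_~ _) q≡r q~y))

    -- Exactly one edge, xy: analyse the last hop of the witness and of its
    -- mirror image; detached witnesses are edgeless, and two shortcuts clash.
    one-edge : x ~ y → x ≁ z → y ≁ z → Reducible x y z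
    one-edge x~y x≁z y≁z w with tidy-witness w | tidy-witness (mirror w)
    ... | w₁ , w₁≤ , tidy₁ | w₂ , w₂≤ , tidy₂
      with last-hop w₁ tidy₁ x~y (⊥-elim ∘ x≁z) | last-hop w₂ tidy₂ (~-sym x~y) (⊥-elim ∘ y≁z)
    ... | inj₁ smaller | _ = smaller-mono w₁≤ smaller
    ... | _ | inj₁ smaller = smaller-mono (≤-trans w₂≤ (≤-reflexive (size-mirror w))) smaller
    ... | inj₂ (inj₂ (r , (w′ , _) , r≁y , r≁z)) | _ = ⊥-elim (independent w′ r≁y y≁z r≁z)
    ... | _ | inj₂ (inj₂ (r , (w′ , _) , r≁x , r≁z)) = ⊥-elim (independent w′ r≁x x≁z r≁z)
    ... | inj₂ (inj₁ short₁) | inj₂ (inj₁ short₂) =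
      ⊥-elim (no-double-shortcut (x≢z w) (y≢z w) x~y x≁z y≁z short₁ short₂)

    -- Edges xy and yz: the last-hop analysis reduces the witness or finds a
    -- shortcut (a detached witness (r, y, z) has the single edge yz).
    path-step : x ~ y → y ~ z → (w : Witness x y z) → SmallerThan (size w) ⊎ Shortcut x y z
    path-step x~y y~z w with tidy-witness w
    ... | w₁ , w₁≤ , tidy₁ with last-hop w₁ tidy₁ x~y (λ _ → y~z)
    ... | inj₁ smaller        = inj₁ (smaller-mono w₁≤ smaller)
    ... | inj₂ (inj₁ short)   = inj₂ short
    ... | inj₂ (inj₂ (r , (w′ , w′≤) , r≁y , r≁z)) =
      inj₁ (smaller-mono (≤-trans (≤-reflexive (size-rotate w′)) (≤-trans w′≤ w₁≤))
                         (one-edge y~z (≁-sym r≁y) (≁-sym r≁z) (rotate w′)))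

    -- Exactly the edges xy and yz: a shortcut r closes the induced 4-cycle x y z r.
    two-edges : x ~ y → y ~ z → x ≁ z → Reducible x y z
    two-edges x~y y~z x≁z w with path-step x~y y~z w
    ... | inj₁ smaller = smaller
    ... | inj₂ (r , r~z , r~x , r≁y , r≢y) =
      ⊥-elim (no-C4 chordal x~y y~z (~-sym r~z) r~x x≁z (≁-sym r≁y) (x≢z w) (≢-sym r≢y))

    -- Shortcuts r, s, t across all three sides of a triangle xyz: an edge
    -- among them closes an induced 4-cycle, otherwise {s, t, r} is an
    -- asteroidal triple, joined by the paths s y t, t z r, r x s.
    no-triple-shortcut : x ~ y → y ~ z → x ~ z → Shortcut x y z → Shortcut y z x → Shortcut z x y → ⊥
    no-triple-shortcut x~y y~z x~z (r , r~z , r~x , r≁y , r≢y) (s , s~x , s~y , s≁z , s≢z) (t , t~y , t~z , t≁x , t≢x)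
      with s ~? t | t ~? r | r ~? s
    ... | yes s~t | _ | _ = no-C4 chordal s~t t~z (~-sym x~z) (~-sym s~x) s≁z t≁x s≢z t≢x
    ... | _ | yes t~r | _ = no-C4 chordal t~r r~x x~y (~-sym t~y) t≁x r≁y t≢x r≢y
    ... | _ | _ | yes r~s = no-C4 chordal r~s s~y y~z (~-sym r~z) r≁y s≁z r≢y s≢z
    ... | no s≁t | no t≁r | no r≁s =
      at-free (s , t , r , s≢t , t≢r , s≢r , s≁t , t≁r , ≁-sym r≁s ,
               path-missing s~y (~-sym t~y) s≢t r≁s r≁y (≁-sym t≁r) ,
               path-missing t~z (~-sym r~z) t≢r s≁t s≁z (≁-sym r≁s) ,
               path-missing r~x (~-sym s~x) (≢-sym s≢r) t≁r t≁x (≁-sym s≁t))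
      where
        s≢t : s ≢ t
        s≢t refl = t≁x s~x
        t≢r : t ≢ r
        t≢r refl = t≁x r~x
        s≢r : s ≢ r
        s≢r refl = r≁y s~y

    -- A triangle: the path analysis of all three rotations yields three shortcuts.
    triangle : x ~ y → y ~ z → x ~ z → Reducible x y z
    triangle x~y y~z x~z w
      with path-step x~y y~z w | path-step y~z (~-sym x~z) (rotate w) | path-step (~-sym x~z) x~y (rotate (rotate w))
    ... | inj₁ smaller | _ | _ = smaller
    ... | _ | inj₁ smaller | _ = smaller-mono (≤-reflexive (size-rotate w)) smaller
    ... | _ | _ | inj₁ smaller = smaller-mono (≤-reflexive (trans (size-rotate (rotate w)) (size-rotate w))) smaller
    ... | inj₂ short₁ | inj₂ short₂ | inj₂ short₃ = ⊥-elim (no-triple-shortcut x~y y~z x~z short₁ short₂ short₃)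

    reducible : Reducible x y z
    reducible {x} {y} {z} w with x ~? y | y ~? z | x ~? z
    ... | no x≁y  | no y≁z  | no x≁z  = ⊥-elim (independent w x≁y y≁z x≁z)
    ... | yes x~y | no y≁z  | no x≁z  = one-edge x~y x≁z y≁z w
    ... | no x≁y  | yes y~z | no x≁z  = reducible-rotate (one-edge y~z (≁-sym x≁y) (≁-sym x≁z)) w
    ... | no x≁y  | no y≁z  | yes x~z = reducible-rotate (reducible-rotate (one-edge (~-sym x~z) (≁-sym y≁z) x≁y)) w
    ... | yes x~y | yes y~z | no x≁z  = two-edges x~y y~z x≁z w
    ... | no x≁y  | yes y~z | yes x~z = reducible-rotate (two-edges y~z (~-sym x~z) (≁-sym x≁y)) w
    ... | yes x~y | no y≁z  | yes x~z = reducible-rotate (reducible-rotate (two-edges (~-sym x~z) x~y (≁-sym y≁z))) w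
    ... | yes x~y | yes y~z | yes x~z = triangle x~y y~z x~z w

    no-weighted-asteroidal-triple : ¬ HasWeightedAsteroidalTriple (adjMatrix G)
    no-weighted-asteroidal-triple (x , y , z , x≢y , y≢z , x≢z , P , Q , R) =
      no-witness reducible
        (witness x≢y y≢z x≢z (fromPathAvoiding P) (fromPathAvoiding Q) (fromPathAvoiding R))

module Backward {n : ℕ} (G : SimpleGraph n) (no-wat : ¬ HasWeightedAsteroidalTriple (adjMatrix G)) where
  open GraphFacts G

  private variable
    x y z : Fin n

  no-triple : x ≢ y → y ≢ z → x ≢ z → AvoidingWalk z x y → AvoidingWalk x y z → AvoidingWalk y z x → ⊥
  no-triple x≢y y≢z x≢z P Q R =
    no-wat (_ , _ , _ , x≢y , y≢z , x≢z , toPathAvoiding P , toPathAvoiding Q , toPathAvoiding R)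

  through : ∀ {c u v w} → c ~ u → c ~ v → u ≁ w → v ≁ w → u ≢ w → c ≢ w → v ≢ w → AvoidingWalk w u v
  through c~u c~v u≁w v≁w u≢w c≢w v≢w =
    avoiding _ (hop (zedgeˡ (~-sym c~u) u≁w) (hop (zedgeʳ c~v v≁w) (stop _))) (u≢w ∷ c≢w ∷ v≢w ∷ [])

  claw-free : ClawFree G
  claw-free c a₁ a₂ a₃ (a₁≢a₂ , a₂≢a₃ , a₁≢a₃ , c~a₁ , c~a₂ , c~a₃ , a₁≁a₂ , a₂≁a₃ , a₁≁a₃) =
    no-triple a₁≢a₂ a₂≢a₃ a₁≢a₃
      (through c~a₁ c~a₂ a₁≁a₃ a₂≁a₃ a₁≢a₃ (~⇒≢ c~a₃) a₂≢a₃)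
      (through c~a₂ c~a₃ (≁-sym a₁≁a₂) (≁-sym a₁≁a₃) (≢-sym a₁≢a₂) (~⇒≢ c~a₁) (≢-sym a₁≢a₃))
      (through c~a₃ c~a₁ (≁-sym a₂≁a₃) a₁≁a₂ (≢-sym a₂≢a₃) (~⇒≢ c~a₂) a₁≢a₂)

  -- A path whose vertices all miss z (and which starts away from z) is an
  -- avoiding walk: every edge is a z-edge, and no vertex after the first can
  -- be z, being adjacent to its predecessor.
  missing⇒avoiding : PathMissing G z x y → x ≢ z → AvoidingWalk z x y
  missing⇒avoiding {z} (vs , path , _ , misses) x≢z =
    avoiding vs (walk-restrict (λ z≁u _ e → zedgeˡ e (≁-sym z≁u)) (gchain⇒walk path) misses)
                (never-z (gchain⇒walk path) misses x≢z)
    where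
      never-z : ∀ {x y vs} → Walk (Adj G) x y vs → All (λ v → ¬ Adj G z v) vs → x ≢ z → All (_≢ z) vs
      never-z (stop _)    _           x≢z = x≢z ∷ []
      never-z (hop x~v p) (z≁x ∷ ms) x≢z = x≢z ∷ never-z p ms (λ { refl → z≁x (~-sym x~v) })

  at-free : ¬ HasAsteroidalTriple G
  at-free (x , y , z , x≢y , y≢z , x≢z , _ , _ , _ , P , Q , R) =
    no-triple x≢y y≢z x≢z (missing⇒avoiding P x≢z) (missing⇒avoiding Q (≢-sym x≢y)) (missing⇒avoiding R (≢-sym y≢z))

  -- On an induced cycle c₀ c₁ … c_{k-1} with k ≥ 4, the vertices c₀, c₁, c₂
  -- form a weighted asteroidal triple: c₀ c₁ avoids c₂, c₁ c₂ avoids c₀, and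
  -- c₂ c₃ … c_{k-1} c₀ avoids c₁ because c₃, …, c_{k-1} miss c₁.
  chordal : Chordal G
  chordal (suc (suc (suc (suc k)))) (s≤s (s≤s (s≤s (s≤s _)))) c (injective , adjacency) =
    no-triple (distinct λ ()) (distinct λ ()) (distinct λ ()) c₀c₁ c₁c₂ c₂…c₀
    where
      distinct : ∀ {i j} → i ≢ j → c i ≢ c j
      distinct i≢j = i≢j ∘ injective

      edge : ∀ i j → CycAdj i j → c i ~ c j
      edge i j = proj₂ (adjacency i j)

      non-edge : ∀ i j {_ : False (cycAdj? i j)} → c i ≁ c j
      non-edge i j {apart} = toWitnessFalse apart ∘ proj₁ (adjacency i j)

      c₀c₁ : AvoidingWalk (c (suc (suc zero))) (c zero) (c (suc zero))
      c₀c₁ = avoiding _ (hop (zedgeˡ (edge _ _ (inj₁ refl)) (non-edge zero (suc (suc zero)))) (stop _))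
                        (distinct (λ ()) ∷ distinct (λ ()) ∷ [])

      c₁c₂ : AvoidingWalk (c zero) (c (suc zero)) (c (suc (suc zero)))
      c₁c₂ = avoiding _ (hop (zedgeʳ (edge _ _ (inj₁ refl)) (non-edge (suc (suc zero)) zero)) (stop _))
                        (distinct (λ ()) ∷ distinct (λ ()) ∷ [])

      stretch : ∃ λ vs → Walk (ZEdge (c (suc zero))) (c (suc (suc zero))) (c (suc (suc (fromℕ (suc k))))) vs ×
                         All (_≢ c (suc zero)) vs
      stretch = ladder {P = _≢ c (suc zero)} (λ i → c (suc (suc i)))
        (λ i → zedgeʳ (edge _ _ (inj₁ (cong (3 +_) (Fin.toℕ-inject₁ i)))) (non-edge (suc (suc (suc i))) (suc zero)))
        (λ i → distinct λ ())

      c₂…c₀ : AvoidingWalk (c (suc zero)) (c (suc (suc zero))) (c zero)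
      c₂…c₀ with stretch
      ... | vs , p , avoids =
        avoiding (vs ∷ʳ c zero)
          (walk-snoc p (zedgeˡ (edge _ zero (inj₂ (inj₂ (inj₂ (refl , cong (2 +_) (Fin.toℕ-fromℕ (suc k)))))))
                               (non-edge (suc (suc (suc (fromℕ k)))) (suc zero))))
          (++⁺ avoids (distinct (λ ()) ∷ []))

theorem4p1 : ∀ {n : ℕ} (G : SimpleGraph n) →
    (Chordal G × ClawFree G × ¬ HasAsteroidalTriple G) ⇔ (¬ HasWeightedAsteroidalTriple (adjMatrix G))
theorem4p1 G = mk⇔
  (λ (chordal , claw-free , at-free) → Forward.Descent.no-weighted-asteroidal-triple G chordal claw-free at-free)
  (λ no-wat → Backward.chordal G no-wat , Backward.claw-free G no-wat , Backward.at-free G no-wat)
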